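{- Let $quad(n)$ denote the number of $n$-totative numbers $t$ such that $t+6$, $t+12$ and $t+18$ are all $n$-totative. Then $quad(1)=quad(2)=0$, $quad(3)=1$, $quad(4)=6$, and $quad(n)=(p_n-4)\,quad(n-1)$ for all $n>4$.
   Context: $p_i$ denotes the $i$th prime. The primorial is $\#(m)=\prod_{i=1}^{m}p_i$. The $m$-primorial set is $\{2,\ldots,\#(m)+1\}$, and an $m$-totative number is an element of it coprime to $\#(m)$. -}

module Defs where

open import Data.Nat using (ℕ; zero; suc; _+_; _*_; _≤?_; _!)
open import Data.Nat.Primality using (Prime; prime?)
open import Data.Nat.Coprimality using (Coprime; coprime?)

open import Data.List using (List; length; filter; upTo; map)
open import Data.Product using (_×_)
open import Relation.Nullary using (Dec; yes; no)
open import Relation.Nullary.Decidable using (_×-dec_)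

-- search for the least prime in [m, m + fuel], returning m + fuel if none
searchPrime : ℕ → ℕ → ℕ
searchPrime fuel m with prime? m
... | yes _ = m
searchPrime zero    m | no _ = m
searchPrime (suc f) m | no _ = searchPrime f (suc m)

-- least prime > m (exists in (m, m! + 1] by Euclid, so fuel m! suffices)
nextPrime : ℕ → ℕ
nextPrime m = searchPrime (m !) (suc m)

-- p i = the i-th prime, 1-indexed: p 1 = 2, p 2 = 3, ... (p 0 = 1 is a dummy)
p : ℕ → ℕ
p zero    = 1
p (suc i) = nextPrime (p i)

primorial : ℕ → ℕ
primorial zero    = 1
primorial (suc m) = p (suc m) * primorial m

Totative : ℕ → ℕ → Set
Totative m t = (2 Data.Nat.≤ t) × (t Data.Nat.≤ suc (primorial m)) × Coprime t (primorial m)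

totative? : ∀ m t → Dec (Totative m t)
totative? m t = (2 ≤? t) ×-dec ((t ≤? suc (primorial m)) ×-dec coprime? t (primorial m))

QuadBase : ℕ → ℕ → Set
QuadBase n t = Totative n t × Totative n (t + 6) × Totative n (t + 12) × Totative n (t + 18)

quadBase? : ∀ n t → Dec (QuadBase n t)
quadBase? n t = totative? n t ×-dec (totative? n (t + 6) ×-dec (totative? n (t + 12) ×-dec totative? n (t + 18)))

primorialSet : ℕ → List ℕ
primorialSet m = map (λ k → k + 2) (upTo (primorial m))

quad : ℕ → ℕ
quad n = length (filter (quadBase? n) (primorialSet n))

module Submission where

-- For n ≥ 4 the primorial M = #(n) is divisible by 210, and every t ∈ {2, …, M + 1} with t, t + 6,
-- t + 12, t + 18 coprime to M already has t + 18 ≤ M + 1: otherwise t ≡ 1 − u (mod M) for some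
-- u < 18, and one of the four shifts shares one of the factors 2, 3, 5, 7 with M. So quad n counts
-- the residues t mod M whose four shifts are coprime to M. For the next prime q ≥ 5 the residues
-- mod q M above such a t are j M + t (j < q); as 0, 6, 12, 18 are distinct mod q and M is
-- invertible mod q, q divides each shift for exactly one j, and these four values of j are
-- distinct, leaving q − 4 lifts.

open import Defs
open import Data.Nat
open import Data.Nat.Properties
open import Data.Nat.Divisibility
open import Data.Nat.Coprimality using (Coprime; coprime?; coprime-divisor) renaming (sym to coprime-sym)
open import Data.Nat.Primality
  using (Prime; prime?; euclidsLemma; prime⇒irreducible; prime⇒nonZero; prime⇒nonTrivial)
open import Data.Nat.Primality.Factorisation using (factorise)
open import Data.Nat.ListAction using (sum; product)
open import Data.Nat.Tactic.RingSolver using (solve-∀)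
open import Data.List using (List; []; _∷_; length; filter; map; applyUpTo; upTo)
open import Data.List.Relation.Unary.All as All using (All; []; _∷_; all?)
open import Data.List.Relation.Unary.AllPairs using (AllPairs; []; _∷_)
open import Data.Product using (_×_; _,_; Σ-syntax)
open import Data.Sum using (inj₁; inj₂)
open import Function using (id; _∘_; _⇔_; mk⇔; Equivalence)
open import Relation.Nullary using (Dec; yes; no; ¬_; contradiction)
open import Relation.Unary using (Decidable)
open import Relation.Binary.PropositionalEquality
  using (_≡_; refl; sym; trans; cong; cong₂; subst; module ≡-Reasoning)
open import Algebra.Properties.CommutativeSemigroup +-commutativeSemigroup
  using (interchange; x∙yz≈y∙xz)

open Equivalence using (to; from)

∑ : ℕ → (ℕ → ℕ) → ℕ
∑ zero    f = 0
∑ (suc n) f = f 0 + ∑ n (f ∘ suc)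

syntax ∑ n (λ i → e) = ∑[ i < n ] e

∑-cong : ∀ n {f g : ℕ → ℕ} → (∀ i → i < n → f i ≡ g i) → ∑ n f ≡ ∑ n g
∑-cong zero    _   = refl
∑-cong (suc n) f≗g = cong₂ _+_ (f≗g 0 z<s) (∑-cong n (λ i i<n → f≗g (suc i) (s<s i<n)))

∑-const : ∀ n c → ∑[ _ < n ] c ≡ n * c
∑-const zero    c = refl
∑-const (suc n) c = cong (c +_) (∑-const n c)

∑-≡0 : ∀ n {f : ℕ → ℕ} → (∀ i → i < n → f i ≡ 0) → ∑ n f ≡ 0
∑-≡0 n f≡0 = trans (∑-cong n f≡0) (trans (∑-const n 0) (*-zeroʳ n))

∑-distrib-+ : ∀ n (f g : ℕ → ℕ) → ∑[ i < n ] (f i + g i) ≡ ∑ n f + ∑ n g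
∑-distrib-+ zero    f g = refl
∑-distrib-+ (suc n) f g = trans (cong (f 0 + g 0 +_) (∑-distrib-+ n (f ∘ suc) (g ∘ suc)))
                                (interchange (f 0) (g 0) (∑ n (f ∘ suc)) (∑ n (g ∘ suc)))

∑-distribˡ-* : ∀ n c (f : ℕ → ℕ) → ∑[ i < n ] (c * f i) ≡ c * ∑ n f
∑-distribˡ-* zero    c f = sym (*-zeroʳ c)
∑-distribˡ-* (suc n) c f =
  trans (cong (c * f 0 +_) (∑-distribˡ-* n c (f ∘ suc))) (sym (*-distribˡ-+ c (f 0) _))

∑-+ : ∀ m n (f : ℕ → ℕ) → ∑ (m + n) f ≡ ∑ m f + ∑[ i < n ] f (m + i)
∑-+ zero    n f = refl
∑-+ (suc m) n f = trans (cong (f 0 +_) (∑-+ m n (f ∘ suc))) (sym (+-assoc (f 0) _ _))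

∑-suc : ∀ n (f : ℕ → ℕ) → ∑ (suc n) f ≡ ∑ n f + f n
∑-suc zero    f = +-identityʳ (f 0)
∑-suc (suc n) f = trans (cong (f 0 +_) (∑-suc n (f ∘ suc))) (sym (+-assoc (f 0) _ _))

∑-rotate : ∀ n (f : ℕ → ℕ) → f n ≡ f 0 → ∑[ i < n ] f (suc i) ≡ ∑ n f
∑-rotate n f fn≡f0 = +-cancelˡ-≡ (f 0) _ _ (begin
  ∑ (suc n) f   ≡⟨ ∑-suc n f ⟩
  ∑ n f + f n   ≡⟨ cong (∑ n f +_) fn≡f0 ⟩
  ∑ n f + f 0   ≡⟨ +-comm (∑ n f) (f 0) ⟩
  f 0 + ∑ n f   ∎)
  where open ≡-Reasoning

∑-periodic : ∀ n (f : ℕ → ℕ) → (∀ i → f (n + i) ≡ f i) → ∀ k → ∑[ i < n ] f (k + i) ≡ ∑ n f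
∑-periodic n f periodic zero    = refl
∑-periodic n f periodic (suc k) = trans
  (∑-periodic n (f ∘ suc) (λ i → trans (cong f (sym (+-suc n i))) (periodic (suc i))) k)
  (∑-rotate n f (trans (cong f (sym (+-identityʳ n))) (periodic 0)))

∑-block : ∀ q M (f : ℕ → ℕ) → ∑ (q * M) f ≡ ∑[ j < q ] ∑[ a < M ] f (j * M + a)
∑-block zero    M f = refl
∑-block (suc q) M f = begin
  ∑ (M + q * M) f                                    ≡⟨ ∑-+ M (q * M) f ⟩
  ∑ M f + ∑[ i < q * M ] f (M + i)                   ≡⟨ cong (∑ M f +_) (∑-block q M (f ∘ (M +_))) ⟩
  ∑ M f + ∑[ j < q ] ∑[ a < M ] f (M + (j * M + a))  ≡⟨ cong (∑ M f +_) (∑-cong q λ j _ →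
                                                          ∑-cong M λ a _ → cong f (+-assoc M (j * M) a)) ⟨
  ∑ M f + ∑[ j < q ] ∑[ a < M ] f (suc j * M + a)    ∎
  where open ≡-Reasoning

∑-swap : ∀ m n (H : ℕ → ℕ → ℕ) → ∑[ j < m ] ∑[ a < n ] H j a ≡ ∑[ a < n ] ∑[ j < m ] H j a
∑-swap zero    n H = sym (∑-≡0 n (λ _ _ → refl))
∑-swap (suc m) n H =
  trans (cong (∑ n (H 0) +_) (∑-swap m n (H ∘ suc))) (sym (∑-distrib-+ n (H 0) _))

∑-≤-length : ∀ n (f : ℕ → ℕ) → (∀ i → f i ≤ 1) → ∑ n f ≤ n
∑-≤-length zero    f f≤1 = z≤n
∑-≤-length (suc n) f f≤1 = +-mono-≤ (f≤1 0) (∑-≤-length n (f ∘ suc) (f≤1 ∘ suc))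

∑≡length⇒≡1 : ∀ n (f : ℕ → ℕ) → (∀ i → f i ≤ 1) → ∑ n f ≡ n → ∀ i → i < n → f i ≡ 1
∑≡length⇒≡1 (suc n) f f≤1 ∑≡ i i<n with f 0 in f0≡ | f≤1 0
... | 0 | _ = contradiction (subst (_≤ n) ∑≡ (∑-≤-length n (f ∘ suc) (f≤1 ∘ suc))) (n≮n n)
∑≡length⇒≡1 (suc n) f f≤1 ∑≡ zero    _         | 1 | _ = f0≡
∑≡length⇒≡1 (suc n) f f≤1 ∑≡ (suc i) (s<s i<n) | 1 | _ =
  ∑≡length⇒≡1 n (f ∘ suc) (f≤1 ∘ suc) (suc-injective ∑≡) i i<n
∑≡length⇒≡1 (suc n) f f≤1 ∑≡ i i<n | 2+ _ | s≤s ()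

χ : {P : Set} → Dec P → ℕ
χ (yes _) = 1
χ (no _)  = 0

χ-yes : {P : Set} (P? : Dec P) → P → χ P? ≡ 1
χ-yes (yes _) _ = refl
χ-yes (no ¬p) p = contradiction p ¬p

χ-no : {P : Set} (P? : Dec P) → ¬ P → χ P? ≡ 0
χ-no (yes p) ¬p = contradiction p ¬p
χ-no (no _)  _  = refl

χ-cong : {P Q : Set} (P? : Dec P) (Q? : Dec Q) → P ⇔ Q → χ P? ≡ χ Q?
χ-cong (yes p) Q? P⇔Q = sym (χ-yes Q? (to P⇔Q p))
χ-cong (no ¬p) Q? P⇔Q = sym (χ-no Q? (¬p ∘ from P⇔Q))

∑-χ-unique : ∀ n {P : ℕ → Set} (P? : Decidable P) →
             (∀ {i j} → i < n → j < n → P i → P j → i ≡ j) → ∑[ i < n ] χ (P? i) ≤ 1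
∑-χ-unique zero    P? unique = z≤n
∑-χ-unique (suc n) P? unique with P? 0
... | yes p₀ = ≤-reflexive (cong suc (∑-≡0 n (λ i i<n →
                 χ-no (P? (suc i)) (λ pᵢ → 0≢1+n (unique z<s (s<s i<n) p₀ pᵢ)))))
... | no _   = ∑-χ-unique n (P? ∘ suc) λ i<n j<n pᵢ pⱼ →
                 suc-injective (unique (s<s i<n) (s<s j<n) pᵢ pⱼ)

length-filter-applyUpTo : ∀ {P : ℕ → Set} (P? : Decidable P) (f : ℕ → ℕ) n →
                          length (filter P? (applyUpTo f n)) ≡ ∑[ i < n ] χ (P? (f i))
length-filter-applyUpTo P? f zero    = refl
length-filter-applyUpTo P? f (suc n) with P? (f 0)
... | yes _ = cong suc (length-filter-applyUpTo P? (f ∘ suc) n)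
... | no _  = length-filter-applyUpTo P? (f ∘ suc) n

map-applyUpTo : ∀ (g f : ℕ → ℕ) n → map g (applyUpTo f n) ≡ applyUpTo (g ∘ f) n
map-applyUpTo g f zero    = refl
map-applyUpTo g f (suc n) = cong (g (f 0) ∷_) (map-applyUpTo g (f ∘ suc) n)

∑-χ-∣ : ∀ q .{{_ : NonZero q}} → ∑[ z < q ] χ (q ∣? z) ≡ 1
∑-χ-∣ (suc q) = cong₂ _+_ (χ-yes (suc q ∣? 0) (suc q ∣0))
  (∑-≡0 q (λ i i<q → χ-no (suc q ∣? suc i) (λ q∣ → <⇒≱ (s<s i<q) (∣⇒≤ q∣))))

∑-χ-∣-window : ∀ q .{{_ : NonZero q}} x → ∑[ z < q ] χ (q ∣? x + z) ≡ 1
∑-χ-∣-window q x = trans (∑-periodic q (λ z → χ (q ∣? z)) shift x) (∑-χ-∣ q)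
  where
  shift : ∀ z → χ (q ∣? q + z) ≡ χ (q ∣? z)
  shift z = χ-cong (q ∣? q + z) (q ∣? z) (mk⇔ (λ q∣ → ∣m+n∣m⇒∣n q∣ ∣-refl) (∣m∣n⇒∣m+n ∣-refl))

∣∧<⇒≡0 : ∀ {q d} → q ∣ d → d < q → d ≡ 0
∣∧<⇒≡0 {d = zero}  _   _   = refl
∣∧<⇒≡0 {d = suc _} q∣d d<q = contradiction q∣d (>⇒∤ d<q)

∣-affine-unique≤ : ∀ {q M z} → Coprime q M → ∀ {i j} → i ≤ j → j < q →
                   q ∣ i * M + z → q ∣ j * M + z → i ≡ j
∣-affine-unique≤ {q} {M} {z} q⊥M {i} {j} i≤j j<q q∣i q∣j = begin
  i          ≡⟨ +-identityʳ i ⟨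
  i + 0      ≡⟨ cong (i +_) d≡0 ⟨
  i + d      ≡⟨ m+[n∸m]≡n i≤j ⟩
  j          ∎
  where
  open ≡-Reasoning
  d : ℕ
  d = j ∸ i
  rearrange : ∀ i d M z → (i + d) * M + z ≡ (i * M + z) + M * d
  rearrange = solve-∀
  split : j * M + z ≡ (i * M + z) + M * d
  split = trans (cong (λ k → k * M + z) (sym (m+[n∸m]≡n i≤j))) (rearrange i d M z)
  d≡0 : d ≡ 0
  d≡0 = ∣∧<⇒≡0 (coprime-divisor q⊥M (∣m+n∣m⇒∣n (subst (q ∣_) split q∣j) q∣i))
               (≤-<-trans (m∸n≤m j i) j<q)

∣-affine-unique : ∀ {q M z} → Coprime q M → ∀ {i j} → i < q → j < q →
                  q ∣ i * M + z → q ∣ j * M + z → i ≡ j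
∣-affine-unique q⊥M {i} {j} i<q j<q q∣i q∣j with ≤-total i j
... | inj₁ i≤j = ∣-affine-unique≤ q⊥M i≤j j<q q∣i q∣j
... | inj₂ j≤i = sym (∣-affine-unique≤ q⊥M j≤i i<q q∣j q∣i)

-- Each h y is at most 1 by uniqueness, and any q consecutive values of h sum to q, so all equal 1.
∑-χ-∣-affine : ∀ {q M} .{{_ : NonZero q}} → Coprime q M → ∀ z → ∑[ j < q ] χ (q ∣? j * M + z) ≡ 1
∑-χ-∣-affine {q} {M} q⊥M z = trans (cong h (sym (+-identityʳ z))) (all≡1 0 (>-nonZero⁻¹ q))
  where
  h : ℕ → ℕ
  h y = ∑[ j < q ] χ (q ∣? j * M + y)
  ∑h≡q : ∑[ w < q ] h (z + w) ≡ q
  ∑h≡q = begin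
    ∑[ w < q ] ∑[ j < q ] χ (q ∣? j * M + (z + w))  ≡⟨ ∑-swap q q (λ j w → χ (q ∣? j * M + (z + w))) ⟨
    ∑[ j < q ] ∑[ w < q ] χ (q ∣? j * M + (z + w))  ≡⟨ ∑-cong q (λ j _ → ∑-cong q λ w _ →
                                                         cong (λ x → χ (q ∣? x)) (+-assoc (j * M) z w)) ⟨
    ∑[ j < q ] ∑[ w < q ] χ (q ∣? j * M + z + w)    ≡⟨ ∑-cong q (λ j _ → ∑-χ-∣-window q (j * M + z)) ⟩
    ∑[ j < q ] 1                                     ≡⟨ trans (∑-const q 1) (*-identityʳ q) ⟩
    q                                                ∎
    where open ≡-Reasoning
  all≡1 : ∀ w → w < q → h (z + w) ≡ 1
  all≡1 = ∑≡length⇒≡1 q (h ∘ (z +_)) (λ w → ∑-χ-unique q _ (∣-affine-unique q⊥M)) ∑h≡q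

coprime-+-multiple : ∀ {N a y} → N ∣ a → Coprime (a + y) N ⇔ Coprime y N
coprime-+-multiple N∣a = mk⇔
  (λ c {_} (d∣y , d∣N) → c (∣m∣n⇒∣m+n (∣-trans d∣N N∣a) d∣y , d∣N))
  (λ c {_} (d∣a+y , d∣N) → c (∣m+n∣m⇒∣n d∣a+y (∣-trans d∣N N∣a) , d∣N))

coprime-∣ʳ : ∀ {a M N} → M ∣ N → Coprime a N → Coprime a M
coprime-∣ʳ M∣N c (d∣a , d∣M) = c (d∣a , ∣-trans d∣M M∣N)

coprime-*ʳ : ∀ {a m n} → Coprime a m → Coprime a n → Coprime a (m * n)
coprime-*ʳ a⊥m a⊥n (d∣a , d∣mn) =
  a⊥n (d∣a , coprime-divisor (λ (e∣d , e∣m) → a⊥m (∣-trans e∣d d∣a , e∣m)) d∣mn)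

prime∤⇒coprime : ∀ {q a} → Prime q → q ∤ a → Coprime q a
prime∤⇒coprime q-prime q∤a (d∣q , d∣a) with prime⇒irreducible q-prime d∣q
... | inj₁ d≡1    = d≡1
... | inj₂ refl   = contradiction d∣a q∤a

prime∤* : ∀ {q m n} → Prime q → q ∤ m → q ∤ n → q ∤ m * n
prime∤* {m = m} {n} q-prime q∤m q∤n q∣mn with euclidsLemma m n q-prime q∣mn
... | inj₁ q∣m = q∤m q∣m
... | inj₂ q∣n = q∤n q∣n

-- a ≢ b (mod q), phrased without subtraction
Incongruent : ℕ → ℕ → ℕ → Set
Incongruent q a b = ∀ x → q ∣ a + x → q ∤ b + x

CoprimeShifts : ℕ → List ℕ → ℕ → Set
CoprimeShifts N ks t = All (λ k → Coprime (k + t) N) ks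

coprimeShifts? : ∀ N ks t → Dec (CoprimeShifts N ks t)
coprimeShifts? N ks t = all? (λ k → coprime? (k + t) N) ks

coprimeShiftCount : ℕ → List ℕ → ℕ
coprimeShiftCount N ks = ∑[ t < N ] χ (coprimeShifts? N ks t)

coprimeShifts-+-multiple : ∀ {N a} ks {y} → N ∣ a → CoprimeShifts N ks (a + y) ⇔ CoprimeShifts N ks y
coprimeShifts-+-multiple {N} {a} ks {y} N∣a = mk⇔ (All.map (to shift)) (All.map (from shift))
  where
  shift : ∀ {k} → Coprime (k + (a + y)) N ⇔ Coprime (k + y) N
  shift {k} rewrite x∙yz≈y∙xz k a y = coprime-+-multiple N∣a

coprimeShifts-∣ : ∀ {M N} ks {t} → M ∣ N → CoprimeShifts N ks t → CoprimeShifts M ks t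
coprimeShifts-∣ ks M∣N = All.map (coprime-∣ʳ M∣N)

module _ {q M : ℕ} (q-prime : Prime q) (q∤M : q ∤ M) where

  private instance
    q-nonZero : NonZero q
    q-nonZero = prime⇒nonZero q-prime

    q-nonTrivial : NonTrivial q
    q-nonTrivial = prime⇒nonTrivial q-prime

  private
    hits : List ℕ → ℕ → ℕ
    hits ks x = sum (map (λ k → χ (q ∣? k + x)) ks)

    hits≡0 : ∀ {k ks x} → All (Incongruent q k) ks → q ∣ k + x → hits ks x ≡ 0
    hits≡0         []             _   = refl
    hits≡0 {x = x} (k≢k′ ∷ k≢ks) q∣ = cong₂ _+_ (χ-no (q ∣? _ + x) (k≢k′ x q∣)) (hits≡0 k≢ks q∣)

    -- q divides at most one shift of x, and the shifts stay coprime to q * M iff it divides none.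
    χ-coprimeShifts-*+hits : ∀ {ks x} → AllPairs (Incongruent q) ks → CoprimeShifts M ks x →
                             χ (coprimeShifts? (q * M) ks x) + hits ks x ≡ 1
    χ-coprimeShifts-*+hits [] [] = refl
    χ-coprimeShifts-*+hits {k ∷ ks} {x} (k≢ks ∷ ks≢) (c ∷ cs) with q ∣? k + x
    ... | yes q∣ = cong₂ _+_
      (χ-no (coprimeShifts? (q * M) (k ∷ ks) x) λ { (c′ ∷ _) → nonTrivial⇒≢1 (c′ (q∣ , m∣m*n M)) })
      (cong suc (hits≡0 k≢ks q∣))
    ... | no q∤ = trans
      (cong (_+ hits ks x) (χ-cong (coprimeShifts? (q * M) (k ∷ ks) x) (coprimeShifts? (q * M) ks x)
        (mk⇔ (λ { (_ ∷ cs′) → cs′ }) (coprime-*ʳ (coprime-sym (prime∤⇒coprime q-prime q∤)) c ∷_))))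
      (χ-coprimeShifts-*+hits ks≢ cs)

    ∑-hits : ∀ ks y → ∑[ j < q ] hits ks (j * M + y) ≡ length ks
    ∑-hits []       y = ∑-≡0 q (λ _ _ → refl)
    ∑-hits (k ∷ ks) y = begin
      ∑[ j < q ] (χ (q ∣? k + (j * M + y)) + hits ks (j * M + y))
        ≡⟨ ∑-distrib-+ q _ _ ⟩
      ∑[ j < q ] χ (q ∣? k + (j * M + y)) + ∑[ j < q ] hits ks (j * M + y)
        ≡⟨ cong₂ _+_ (∑-cong q (λ j _ → cong (λ z → χ (q ∣? z)) (x∙yz≈y∙xz k (j * M) y))) (∑-hits ks y) ⟩
      ∑[ j < q ] χ (q ∣? j * M + (k + y)) + length ks
        ≡⟨ cong (_+ length ks) (∑-χ-∣-affine (prime∤⇒coprime q-prime q∤M) (k + y)) ⟩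
      suc (length ks) ∎
      where open ≡-Reasoning

  ∑-χ-coprimeShifts-fiber : ∀ {ks} → AllPairs (Incongruent q) ks → ∀ y →
    ∑[ j < q ] χ (coprimeShifts? (q * M) ks (j * M + y)) ≡ (q ∸ length ks) * χ (coprimeShifts? M ks y)
  ∑-χ-coprimeShifts-fiber {ks} incongruent y with coprimeShifts? M ks y
  ... | no ¬cs = trans (∑-≡0 q (λ j _ → χ-no (coprimeShifts? (q * M) ks (j * M + y))
                   (¬cs ∘ to (coprimeShifts-+-multiple ks (n∣m*n j)) ∘ coprimeShifts-∣ ks (n∣m*n q))))
                   (sym (*-zeroʳ (q ∸ length ks)))
  ... | yes cs = begin
    S                                    ≡⟨ m+n∸n≡m S l ⟨
    S + l ∸ l                            ≡⟨ cong (λ h → S + h ∸ l) (∑-hits ks y) ⟨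
    S + ∑[ j < q ] hits ks (j * M + y) ∸ l
      ≡⟨ cong (_∸ l) (∑-distrib-+ q _ _) ⟨
    ∑[ j < q ] (χ (S? j) + hits ks (j * M + y)) ∸ l
      ≡⟨ cong (_∸ l) (∑-cong q (λ j _ → χ-coprimeShifts-*+hits incongruent
                                           (from (coprimeShifts-+-multiple ks (n∣m*n j)) cs))) ⟩
    ∑[ j < q ] 1 ∸ l                    ≡⟨ cong (_∸ l) (trans (∑-const q 1) (*-identityʳ q)) ⟩
    q ∸ l                                ≡⟨ *-identityʳ (q ∸ l) ⟨
    (q ∸ l) * 1                          ∎
    where
    open ≡-Reasoning
    l : ℕ
    l = length ks
    S? : ∀ j → Dec (CoprimeShifts (q * M) ks (j * M + y))
    S? j = coprimeShifts? (q * M) ks (j * M + y)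
    S : ℕ
    S = ∑[ j < q ] χ (S? j)

  coprimeShiftCount-* : ∀ {ks} → AllPairs (Incongruent q) ks →
                        coprimeShiftCount (q * M) ks ≡ (q ∸ length ks) * coprimeShiftCount M ks
  coprimeShiftCount-* {ks} incongruent = begin
    ∑[ t < q * M ] χ (coprimeShifts? (q * M) ks t)
      ≡⟨ ∑-block q M _ ⟩
    ∑[ j < q ] ∑[ y < M ] χ (coprimeShifts? (q * M) ks (j * M + y))
      ≡⟨ ∑-swap q M _ ⟩
    ∑[ y < M ] ∑[ j < q ] χ (coprimeShifts? (q * M) ks (j * M + y))
      ≡⟨ ∑-cong M (λ y _ → ∑-χ-coprimeShifts-fiber incongruent y) ⟩
    ∑[ y < M ] ((q ∸ length ks) * χ (coprimeShifts? M ks y))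
      ≡⟨ ∑-distribˡ-* M (q ∸ length ks) _ ⟩
    (q ∸ length ks) * coprimeShiftCount M ks ∎
    where open ≡-Reasoning

searchPrime-≥ : ∀ fuel m → m ≤ searchPrime fuel m
searchPrime-≥ fuel m with prime? m
... | yes _ = ≤-refl
searchPrime-≥ zero       m | no _ = ≤-refl
searchPrime-≥ (suc fuel) m | no _ = ≤-trans (n≤1+n m) (searchPrime-≥ fuel (suc m))

searchPrime-prime : ∀ fuel m {r} → Prime r → m ≤ r → r ≤ fuel + m → Prime (searchPrime fuel m)
searchPrime-prime fuel m r-prime m≤r r≤ with prime? m
... | yes m-prime = m-prime
searchPrime-prime zero m r-prime m≤r r≤ | no ¬m-prime =
  contradiction (subst Prime (≤-antisym r≤ m≤r) r-prime) ¬m-prime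
searchPrime-prime (suc fuel) m {r} r-prime m≤r r≤ | no ¬m-prime with m≤n⇒m<n∨m≡n m≤r
... | inj₁ m<r  = searchPrime-prime fuel (suc m) r-prime m<r (subst (r ≤_) (sym (+-suc fuel m)) r≤)
... | inj₂ refl = contradiction r-prime ¬m-prime

prime-factor : ∀ n → 2 ≤ n → Σ[ r ∈ ℕ ] Prime r × r ∣ n
prime-factor 1      (s≤s ())
prime-factor (2+ k) _ with factorise (2+ k)
... | record { factors = r ∷ rs ; isFactorisation = r*rs≡n ; factorsPrime = r-prime ∷ _ } =
  r , r-prime , subst (r ∣_) (sym r*rs≡n) (m∣m*n (product rs))

∣! : ∀ {k n} → 1 ≤ k → k ≤ n → k ∣ n !
∣! {suc k} _ k≤n = ∣-trans (m∣m*n (k !)) (m≤n⇒m!∣n! k≤n)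

-- Euclid: a prime factor r of m! + 1 exceeds m, so the search in (m, m! + m] succeeds.
nextPrime-prime : ∀ m → Prime (nextPrime m)
nextPrime-prime m with prime-factor (m ! + 1) (+-monoˡ-≤ 1 (1≤n! m))
... | r , r-prime , r∣m!+1 = searchPrime-prime (m !) (suc m) r-prime m<r r≤
  where
  instance
    r-nonTrivial : NonTrivial r
    r-nonTrivial = prime⇒nonTrivial r-prime
  m<r : m < r
  m<r with m <? r
  ... | yes m<r = m<r
  ... | no m≮r =
    contradiction (∣1⇒≡1 (∣m+n∣m⇒∣n r∣m!+1 (∣! (<⇒≤ (nonTrivial⇒n>1 r)) (≮⇒≥ m≮r)))) nonTrivial⇒≢1
  r≤ : r ≤ m ! + suc m
  r≤ = ≤-trans (∣⇒≤ {{≢-nonZero (m+1+n≢0 (m !))}} r∣m!+1) (+-monoʳ-≤ (m !) (s≤s z≤n))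

p-prime : ∀ i → Prime (p (suc i))
p-prime i = nextPrime-prime (p i)

p-< : ∀ i → p i < p (suc i)
p-< i = searchPrime-≥ (p i !) (suc (p i))

i<p : ∀ i → i < p i
i<p zero    = z<s
i<p (suc i) = ≤-trans (s<s (i<p i)) (p-< i)

primorial-∣ : ∀ {m n} → m ≤ n → primorial m ∣ primorial n
primorial-∣ {m} {n} m≤n with m≤n⇒m<n∨m≡n m≤n
... | inj₂ refl = ∣-refl
primorial-∣ {m} {suc n} _ | inj₁ (s≤s m≤n) = ∣-trans (primorial-∣ m≤n) (n∣m*n (p (suc n)))

prime∤primorial : ∀ {r} m → Prime r → p m < r → r ∤ primorial m
prime∤primorial zero    r-prime _   r∣1 = nonTrivial⇒≢1 {{prime⇒nonTrivial r-prime}} (∣1⇒≡1 r∣1)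
prime∤primorial (suc m) r-prime p<r r∣ with euclidsLemma (p (suc m)) (primorial m) r-prime r∣
... | inj₁ r∣p = <⇒≱ p<r (∣⇒≤ {{prime⇒nonZero (p-prime m)}} r∣p)
... | inj₂ r∣primorial = prime∤primorial m r-prime (<-trans (p-< m) p<r) r∣primorial

quadOffsets : List ℕ
quadOffsets = 0 ∷ 6 ∷ 12 ∷ 18 ∷ []

incongruent-+ : ∀ {q d a} → q ∤ d → Incongruent q a (d + a)
incongruent-+ {q} {d} {a} q∤d x q∣a+x q∣d+a+x =
  q∤d (∣m+n∣m⇒∣n (subst (q ∣_) (trans (+-assoc d a x) (+-comm d (a + x))) q∣d+a+x) q∣a+x)

quadOffsets-incongruent : ∀ {q} → Prime q → 5 ≤ q → AllPairs (Incongruent q) quadOffsets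
quadOffsets-incongruent {q} q-prime 5≤q =
    (incongruent-+ q∤6 ∷ incongruent-+ q∤12 ∷ incongruent-+ q∤18 ∷ [])
  ∷ (incongruent-+ q∤6 ∷ incongruent-+ q∤12 ∷ [])
  ∷ (incongruent-+ q∤6 ∷ [])
  ∷ []
  ∷ []
  where
  q∤2 : q ∤ 2
  q∤2 = >⇒∤ (≤-trans (s≤s (s≤s (s≤s z≤n))) 5≤q)
  q∤3 : q ∤ 3
  q∤3 = >⇒∤ (≤-trans (s≤s (s≤s (s≤s (s≤s z≤n)))) 5≤q)
  q∤6 : q ∤ 6
  q∤6 = prime∤* q-prime q∤2 q∤3
  q∤12 : q ∤ 12
  q∤12 = prime∤* q-prime q∤2 q∤6
  q∤18 : q ∤ 18
  q∤18 = prime∤* q-prime q∤3 q∤6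

¬coprime-+ : ∀ d {X} c .{{_ : NonTrivial d}} → d ∣ X → d ∣ c → ¬ Coprime (c + X) X
¬coprime-+ d c d∣X d∣c c+X⊥X = nonTrivial⇒≢1 (c+X⊥X (∣m∣n⇒∣m+n d∣c d∣X , d∣X))

-- t ≡ 1 − u (mod M); each clause names a prime dividing M and one of t, t + 6, t + 12, t + 18.
wrapped-¬coprimeShifts : ∀ u {t M} → u < 18 → u + t ≡ suc M → 2 ∣ M → 3 ∣ M → 5 ∣ M → 7 ∣ M →
                         ¬ CoprimeShifts M quadOffsets t
wrapped-¬coprimeShifts 0  _ refl _  _  _  7∣ (_ ∷ c ∷ _)         = ¬coprime-+ 7 7 7∣ ∣-refl c
wrapped-¬coprimeShifts 1  _ refl 2∣ _  _  _  (c ∷ _)             = ¬coprime-+ 2 0 2∣ (2 ∣0) c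
wrapped-¬coprimeShifts 2  _ refl _  _  5∣ _  (_ ∷ c ∷ _)         = ¬coprime-+ 5 5 5∣ ∣-refl c
wrapped-¬coprimeShifts 3  _ refl 2∣ _  _  _  (_ ∷ c ∷ _)         = ¬coprime-+ 2 4 2∣ (divides 2 refl) c
wrapped-¬coprimeShifts 4  _ refl _  3∣ _  _  (_ ∷ c ∷ _)         = ¬coprime-+ 3 3 3∣ ∣-refl c
wrapped-¬coprimeShifts 5  _ refl 2∣ _  _  _  (_ ∷ c ∷ _)         = ¬coprime-+ 2 2 2∣ ∣-refl c
wrapped-¬coprimeShifts 6  _ refl _  _  _  7∣ (_ ∷ _ ∷ c ∷ _)     = ¬coprime-+ 7 7 7∣ ∣-refl c
wrapped-¬coprimeShifts 7  _ refl 2∣ _  _  _  (_ ∷ c ∷ _)         = ¬coprime-+ 2 0 2∣ (2 ∣0) c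
wrapped-¬coprimeShifts 8  _ refl _  _  5∣ _  (_ ∷ _ ∷ c ∷ _)     = ¬coprime-+ 5 5 5∣ ∣-refl c
wrapped-¬coprimeShifts 9  _ refl 2∣ _  _  _  (_ ∷ _ ∷ c ∷ _)     = ¬coprime-+ 2 4 2∣ (divides 2 refl) c
wrapped-¬coprimeShifts 10 _ refl _  3∣ _  _  (_ ∷ _ ∷ c ∷ _)     = ¬coprime-+ 3 3 3∣ ∣-refl c
wrapped-¬coprimeShifts 11 _ refl 2∣ _  _  _  (_ ∷ _ ∷ c ∷ _)     = ¬coprime-+ 2 2 2∣ ∣-refl c
wrapped-¬coprimeShifts 12 _ refl _  _  _  7∣ (_ ∷ _ ∷ _ ∷ c ∷ _) = ¬coprime-+ 7 7 7∣ ∣-refl c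
wrapped-¬coprimeShifts 13 _ refl 2∣ _  _  _  (_ ∷ _ ∷ c ∷ _)     = ¬coprime-+ 2 0 2∣ (2 ∣0) c
wrapped-¬coprimeShifts 14 _ refl _  _  5∣ _  (_ ∷ _ ∷ _ ∷ c ∷ _) = ¬coprime-+ 5 5 5∣ ∣-refl c
wrapped-¬coprimeShifts 15 _ refl 2∣ _  _  _  (_ ∷ _ ∷ _ ∷ c ∷ _) = ¬coprime-+ 2 4 2∣ (divides 2 refl) c
wrapped-¬coprimeShifts 16 _ refl _  3∣ _  _  (_ ∷ _ ∷ _ ∷ c ∷ _) = ¬coprime-+ 3 3 3∣ ∣-refl c
wrapped-¬coprimeShifts 17 _ refl 2∣ _  _  _  (_ ∷ _ ∷ _ ∷ c ∷ _) = ¬coprime-+ 2 2 2∣ ∣-refl c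
wrapped-¬coprimeShifts (suc (suc (suc (suc (suc (suc (suc (suc (suc (suc (suc (suc (suc (suc (suc (suc (suc (suc u))))))))))))))))))
  u<18 _ _ _ _ _ = contradiction (m≤m+n 18 u) (<⇒≱ u<18)

quadBase⇔coprimeShifts : ∀ {n t} → 4 ≤ n → 2 ≤ t → t ≤ suc (primorial n) →
                         QuadBase n t ⇔ CoprimeShifts (primorial n) quadOffsets t
quadBase⇔coprimeShifts {n} {t} 4≤n 2≤t t≤1+M = mk⇔ forward backward
  where
  M : ℕ
  M = primorial n
  comm : ∀ k → Coprime (t + k) M ⇔ Coprime (k + t) M
  comm k rewrite +-comm t k = mk⇔ (λ c → c) (λ c → c)
  forward : QuadBase n t → CoprimeShifts M quadOffsets t
  forward ((_ , _ , c₀) , (_ , _ , c₆) , (_ , _ , c₁₂) , (_ , _ , c₁₈)) =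
    c₀ ∷ to (comm 6) c₆ ∷ to (comm 12) c₁₂ ∷ to (comm 18) c₁₈ ∷ []
  backward : CoprimeShifts M quadOffsets t → QuadBase n t
  backward cs@(c₀ ∷ c₆ ∷ c₁₂ ∷ c₁₈ ∷ []) =
    (2≤t , t≤1+M , c₀) , totative (m≤m+n 6 12) c₆ , totative (m≤m+n 12 6) c₁₂ , totative ≤-refl c₁₈
    where
    210∣M : 210 ∣ M
    210∣M = primorial-∣ 4≤n
    t+18≤1+M : t + 18 ≤ suc M
    t+18≤1+M with t + 18 ≤? suc M
    ... | yes ≤ = ≤
    ... | no ≰ = contradiction cs (wrapped-¬coprimeShifts (suc M ∸ t)
      (m<n+o⇒m∸n<o (suc M) t (≰⇒> ≰)) (m∸n+n≡m t≤1+M)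
      (∣-trans (divides 105 refl) 210∣M) (∣-trans (divides 70 refl) 210∣M)
      (∣-trans (divides 42 refl) 210∣M) (∣-trans (divides 30 refl) 210∣M))
    totative : ∀ {k} → k ≤ 18 → Coprime (k + t) M → Totative n (t + k)
    totative {k} k≤18 c = ≤-trans 2≤t (m≤m+n t k) , ≤-trans (+-monoʳ-≤ t k≤18) t+18≤1+M , from (comm k) c

quad≡coprimeShiftCount : ∀ n → 4 ≤ n → quad n ≡ coprimeShiftCount (primorial n) quadOffsets
quad≡coprimeShiftCount n 4≤n = begin
  length (filter (quadBase? n) (map (_+ 2) (upTo M)))
    ≡⟨ cong (length ∘ filter (quadBase? n)) (map-applyUpTo (_+ 2) id M) ⟩
  length (filter (quadBase? n) (applyUpTo (_+ 2) M))
    ≡⟨ length-filter-applyUpTo (quadBase? n) (_+ 2) M ⟩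
  ∑[ r < M ] χ (quadBase? n (r + 2))
    ≡⟨ ∑-cong M (λ r r<M → trans
         (χ-cong (quadBase? n (r + 2)) (coprimeShifts? M quadOffsets (r + 2))
                 (quadBase⇔coprimeShifts 4≤n (m≤n+m 2 r) (subst (_≤ suc M) (+-comm 2 r) (s≤s r<M))))
         (cong (χ ∘ coprimeShifts? M quadOffsets) (+-comm r 2))) ⟩
  ∑[ r < M ] χ (coprimeShifts? M quadOffsets (2 + r))
    ≡⟨ ∑-periodic M (χ ∘ coprimeShifts? M quadOffsets) periodic 2 ⟩
  coprimeShiftCount M quadOffsets ∎
  where
  open ≡-Reasoning
  M : ℕ
  M = primorial n
  periodic : ∀ r → χ (coprimeShifts? M quadOffsets (M + r)) ≡ χ (coprimeShifts? M quadOffsets r)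
  periodic r = χ-cong _ _ (coprimeShifts-+-multiple quadOffsets ∣-refl)

quad-suc : ∀ m → 4 ≤ m → quad (suc m) ≡ (p (suc m) ∸ 4) * quad m
quad-suc m 4≤m = begin
  quad (suc m)                             ≡⟨ quad≡coprimeShiftCount (suc m) (m≤n⇒m≤1+n 4≤m) ⟩
  coprimeShiftCount (q * M) quadOffsets    ≡⟨ coprimeShiftCount-* q-prime q∤M
                                                (quadOffsets-incongruent q-prime 5≤q) ⟩
  (q ∸ 4) * coprimeShiftCount M quadOffsets ≡⟨ cong ((q ∸ 4) *_) (quad≡coprimeShiftCount m 4≤m) ⟨
  (q ∸ 4) * quad m                         ∎
  where
  open ≡-Reasoning
  q M : ℕ
  q = p (suc m)
  M = primorial m
  q-prime : Prime q
  q-prime = p-prime m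
  q∤M : q ∤ M
  q∤M = prime∤primorial m q-prime (p-< m)
  5≤q : 5 ≤ q
  5≤q = ≤-trans (s≤s 4≤m) (<⇒≤ (i<p (suc m)))

corollary5 : (quad 1 ≡ 0) × (quad 2 ≡ 0) × (quad 3 ≡ 1) × (quad 4 ≡ 6)
    × (∀ (n : ℕ) → 4 < n → quad n ≡ (p n ∸ 4) * quad (n ∸ 1))
corollary5 = refl , refl , refl , refl , λ where (suc m) (s≤s 4≤m) → quad-suc m 4≤m
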